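{- Let ${\tt w}=\ell_0\ell_1\ell_2\cdots\in\mathcal{W}$ begin with the letter ${\tt a}$. Then both $\Delta p_{\tt a}$ and $\Delta p_{\tt b}$ are factors of ${\tt w}$ (that is, there exist maps $\sigma,\sigma':\{{\tt a},{\tt b}\}\to\mathbb{N}$ with $\Delta p_{\tt a}(n)=\sigma(\ell_{n-1})$ and $\Delta p_{\tt b}(n)=\sigma'(\ell_{n-1})$ for all $n\geqslant1$) if and only if either ${\tt w}={\tt f}$ or ${\tt w}=({\tt a}{\tt b})^\omega$. In particular, ${\tt f}$ is the only word in $\mathcal{W}$ beginning with ${\tt a}$ which is isomorphic to both $\Delta p_{\tt a}$ and $\Delta p_{\tt b}$ (i.e. for which such maps $\sigma,\sigma'$ can be chosen injective).
   Context: Words are infinite one-sided words over $\{{\tt a},{\tt b}\}$ indexed from position $0$; $\mathcal{W}$ is the set of such words in which both letters occur infinitely often. For ${\tt w}\in\mathcal{W}$ and $n\geqslant1$, $p_{\tt a}(n)$ (resp. $p_{\tt b}(n)$) is the position of the $n$-th occurrence of ${\tt a}$ (resp. ${\tt b}$), and $\Delta s(n)=s(n+1)-s(n)$ for a sequence $s$. $({\tt a}{\tt b})^\omega$ is the periodic word ${\tt a}{\tt b}{\tt a}{\tt b}\cdots$. The Fibonacci word ${\tt f}=\lim_{n\to\infty}\varrho_F^n({\tt a})={\tt a}{\tt b}{\tt a}{\tt a}{\tt b}{\tt a}{\tt b}{\tt a}\cdots$ is the fixed point of the substitution $\varrho_F:{\tt a}\mapsto{\tt a}{\tt b},\ {\tt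 b}\mapsto{\tt a}$. A sequence taking finitely many values is viewed as a word; it is a factor of ${\tt w}$ if it is the image of ${\tt w}$ under a letter-to-letter map, and isomorphic to ${\tt w}$ if that map is a bijection onto its set of values. -}

module Defs where

open import Data.Nat using (ℕ; zero; suc; _+_; _∸_; _≤_; _<_)
open import Data.Nat using () renaming (_≟_ to _≟ℕ_)
open import Data.Bool using (Bool; true; false; if_then_else_)
open import Data.Nat.Base using (_%_)
open import Data.List using (List; []; _∷_; concatMap)
open import Data.Product using (Σ; ∃; _×_; _,_)
open import Relation.Binary.PropositionalEquality using (_≡_)
open import Function.Definitions using (Injective)

data Letter : Set where
  a b : Letter

_≟L_ : (x y : Letter) → Bool
a ≟L a = true
b ≟L b = true
a ≟L b = false
b ≟L a = false

Word : Set
Word = ℕ → Letter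

_≈_ : Word → Word → Set
w ≈ v = ∀ n → w n ≡ v n

InfOften : Letter → Word → Set
InfOften x w = ∀ n → ∃ λ m → n ≤ m × w m ≡ x

InW : Word → Set
InW w = InfOften a w × InfOften b w

count : Letter → Word → ℕ → ℕ
count x w zero = 0
count x w (suc k) = count x w k + (if x ≟L w k then 1 else 0)

-- k = p_x(n): position k is the n-th occurrence of x (n ≥ 1)
IsPos : Letter → Word → ℕ → ℕ → Set
IsPos x w n k = (w k ≡ x) × (suc (count x w k) ≡ n)

-- Δp_x(n) = d, i.e. p_x(n+1) - p_x(n) = d
ΔpIs : Letter → Word → ℕ → ℕ → Set
ΔpIs x w n d = ∀ i j → IsPos x w n i → IsPos x w (suc n) j → j ∸ i ≡ d

ΔpFactorVia : Letter → Word → (Letter → ℕ) → Set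
ΔpFactorVia x w σ = ∀ n → ΔpIs x w (suc n) (σ (w n))

ρF : Letter → List Letter
ρF a = a ∷ b ∷ []
ρF b = a ∷ []

ρF* : List Letter → List Letter
ρF* = concatMap ρF

iter : ℕ → List Letter → List Letter
iter zero u = u
iter (suc n) u = iter n (ρF* u)

nthOr : Letter → List Letter → ℕ → Letter
nthOr d [] _ = d
nthOr d (x ∷ xs) zero = x
nthOr d (x ∷ xs) (suc i) = nthOr d xs i

-- f(i) = i-th letter of ρF^(i+1)(a), which has length ≥ i+2 and is a prefix of f
fib : Word
fib i = nthOr a (iter (suc i) (a ∷ [])) i

abω : Word
abω n = if (n % 2) ≟ℕ' 0 then a else b
  where
  _≟ℕ'_ : ℕ → ℕ → Bool
  zero ≟ℕ' zero = true
  _ ≟ℕ' _ = false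

{-# OPTIONS --safe #-}
-- Δp_x(n) = σ(ℓₙ₋₁) says p_x(n+1) = p_x(n) + σ(ℓₙ₋₁). Starting from p_a(1) = 0 this recursion
-- generates every position of a, so a word beginning with a is determined by σ. Writing
-- σ = (σ(a), σ(b)), the gaps visible in the prefix of length 10 force σ = (2,1) or σ = (2,2),
-- apart from two degenerate cases, σ(a) = 1, and a prefix abb with σ′(b) = 1, where the
-- recursion fills the whole tail with one letter, which is impossible in 𝒲. Conversely,
-- f = ρF(f) puts its (n+1)-th a at position n + |ℓ₀⋯ℓₙ₋₁|ₐ and a b right after the image of
-- each a, so f has σ = (2,1) and σ′ = (3,2), while (ab)^ω has σ = σ′ = (2,2). Only the first
-- σ is injective.
module Submission where

open import Defs
open import Data.Nat using (ℕ; zero; suc; _+_; _*_; _∸_; _≤_; _<_; z≤n; s≤s; s≤s⁻¹; _<?_; _≤?_)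
import Data.Nat as ℕ
open import Data.Nat.Properties hiding (_≟_)
open import Data.Bool using (if_then_else_)
open import Data.Unit using (⊤; tt)
open import Data.List using (List; []; _∷_; _++_; length; zip)
open import Data.List.Properties using (concatMap-++)
open import Data.List.Membership.Propositional using (_∈_)
open import Data.List.Membership.DecPropositional using (_∈?_)
open import Data.List.Relation.Unary.All as All using (All; []; _∷_; all?)
open import Data.Product using (Σ; ∃; _×_; _,_; proj₁; proj₂; map₁; map₂)
open import Data.Product.Properties using (≡-dec)
open import Data.Sum using (_⊎_; inj₁; inj₂; [_,_]′)
import Data.Sum as Sum
open import Function using (const; _∘′_)
open import Function.Bundles using (_⇔_; mk⇔)
open import Function.Definitions using (Injective)
open import Relation.Binary.Definitions using (DecidableEquality; tri<; tri≈; tri>)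
open import Relation.Binary.PropositionalEquality
  using (_≡_; _≢_; _≗_; refl; sym; trans; cong; cong₂; subst; subst₂; module ≡-Reasoning)
open import Relation.Nullary using (Dec; yes; no; contradiction)
open import Relation.Nullary.Decidable using (_×-dec_; _⊎-dec_; _→-dec_; toWitness)
open import Relation.Unary using (Decidable)

_≟_ : DecidableEquality Letter
a ≟ a = yes refl
b ≟ b = yes refl
a ≟ b = no λ ()
b ≟ a = no λ ()

a≢b : a ≢ b
a≢b ()

letter-cases : ∀ x → x ≡ a ⊎ x ≡ b
letter-cases a = inj₁ refl
letter-cases b = inj₂ refl

≢-≢⇒≡ : ∀ {x y z : Letter} → y ≢ x → z ≢ x → y ≡ z
≢-≢⇒≡ {a} {a} y≢x _ = contradiction refl y≢x
≢-≢⇒≡ {a} {b} {a} _ z≢x = contradiction refl z≢x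
≢-≢⇒≡ {a} {b} {b} _ _ = refl
≢-≢⇒≡ {b} {a} {a} _ _ = refl
≢-≢⇒≡ {b} {a} {b} _ z≢x = contradiction refl z≢x
≢-≢⇒≡ {b} {b} y≢x _ = contradiction refl y≢x

count-suc-≡ : ∀ {x w} k → w k ≡ x → count x w (suc k) ≡ suc (count x w k)
count-suc-≡ {a} {w} k wk≡x rewrite wk≡x = +-comm (count a w k) 1
count-suc-≡ {b} {w} k wk≡x rewrite wk≡x = +-comm (count b w k) 1

count-suc-≢ : ∀ {x y w} k → x ≢ y → w k ≡ y → count x w (suc k) ≡ count x w k
count-suc-≢ {a} {a} k x≢y _ = contradiction refl x≢y
count-suc-≢ {a} {b} {w} k _ wk≡y rewrite wk≡y = +-identityʳ (count a w k)
count-suc-≢ {b} {a} {w} k _ wk≡y rewrite wk≡y = +-identityʳ (count b w k)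
count-suc-≢ {b} {b} k x≢y _ = contradiction refl x≢y

count-cong : ∀ {x w v} k → (∀ i → i < k → w i ≡ v i) → count x w k ≡ count x v k
count-cong zero _ = refl
count-cong {x} (suc k) w≡v =
  cong₂ (λ c l → c + (if x ≟L l then 1 else 0))
        (count-cong k (λ i i<k → w≡v i (m<n⇒m<1+n i<k))) (w≡v k (n<1+n k))

count-≤ : ∀ {x w} k → count x w k ≤ k
count-≤ zero = z≤n
count-≤ {x} {w} (suc k) with x ≟ w k
... | yes refl = subst (_≤ suc k) (sym (count-suc-≡ k refl)) (s≤s (count-≤ k))
... | no x≢wk = subst (_≤ suc k) (sym (count-suc-≢ k x≢wk refl)) (m≤n⇒m≤1+n (count-≤ k))

count-mono : ∀ {x w m n} → m ≤ n → count x w m ≤ count x w n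
count-mono {n = zero} z≤n = ≤-refl
count-mono {x} {w} {n = suc n} m≤1+n with m≤n⇒m<n∨m≡n m≤1+n
... | inj₁ m<1+n = ≤-trans (count-mono (s≤s⁻¹ m<1+n)) (m≤m+n (count x w n) _)
... | inj₂ refl = ≤-refl

count-cancel-< : ∀ {x w i j} → count x w i < count x w j → i < j
count-cancel-< {i = i} {j} lt with i <? j
... | yes i<j = i<j
... | no i≮j = contradiction (count-mono (≮⇒≥ i≮j)) (<⇒≱ lt)

count-suc-shift : ∀ x w k → count x w (suc k) ≡ count x w 1 + count x (w ∘′ suc) k
count-suc-shift x w zero = sym (+-identityʳ _)
count-suc-shift x w (suc k) =
  trans (cong (_+ ind) (count-suc-shift x w k)) (+-assoc (count x w 1) (count x (w ∘′ suc) k) ind)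
  where ind = if x ≟L w (suc k) then 1 else 0

IsPos-≤ : ∀ {x w n k} → IsPos x w (suc n) k → n ≤ k
IsPos-≤ {k = k} (_ , c) = subst (_≤ k) (suc-injective c) (count-≤ k)

IsPos-strictMono : ∀ {x w m n i j} → IsPos x w m i → IsPos x w n j → i < j → m < n
IsPos-strictMono {x} {w} {i = i} {j} (wi , refl) (_ , refl) i<j = begin-strict
  suc (count x w i)  ≡⟨ count-suc-≡ i wi ⟨
  count x w (suc i)  ≤⟨ count-mono i<j ⟩
  count x w j        <⟨ n<1+n _ ⟩
  suc (count x w j)  ∎
  where open ≤-Reasoning

IsPos-functional : ∀ {x w n i j} → IsPos x w n i → IsPos x w n j → i ≡ j
IsPos-functional {i = i} {j} pi pj with <-cmp i j
... | tri< i<j _ _ = contradiction (IsPos-strictMono pi pj i<j) (<-irrefl refl)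
... | tri≈ _ i≡j _ = i≡j
... | tri> _ _ j<i = contradiction (IsPos-strictMono pj pi j<i) (<-irrefl refl)

IsPos-< : ∀ {x w n i j} → IsPos x w (suc n) i → IsPos x w (suc (suc n)) j → i < j
IsPos-< {n = n} (_ , ci) (_ , cj) =
  count-cancel-< (subst₂ _<_ (sym (suc-injective ci)) (sym (suc-injective cj)) (n<1+n n))

IsPos-between : ∀ {x w n i j k} → IsPos x w (suc n) i → IsPos x w (suc (suc n)) j →
                i < k → k < j → w k ≢ x
IsPos-between pi pj i<k k<j wk≡x =
  <⇒≱ (s≤s⁻¹ (IsPos-strictMono pi pk i<k)) (s≤s⁻¹ (s≤s⁻¹ (IsPos-strictMono pk pj k<j)))
  where pk = wk≡x , refl

IsPos-find : ∀ {x w} n m → n < count x w m → ∃ λ j → j < m × IsPos x w (suc n) j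
IsPos-find {x} {w} n (suc m) n<c with n <? count x w m | x ≟ w m
... | yes n<c′ | _ = map₂ (map₁ m<n⇒m<1+n) (IsPos-find n m n<c′)
... | no n≮c′ | yes refl = m , n<1+n m , refl ,
  cong suc (≤-antisym (≮⇒≥ n≮c′) (s≤s⁻¹ (subst (n <_) (count-suc-≡ m refl) n<c)))
... | no n≮c′ | no x≢wm = contradiction (subst (n <_) (count-suc-≢ m x≢wm refl) n<c) n≮c′

IsPos-next : ∀ {x w n i} → InfOften x w → IsPos x w n i → ∃ (IsPos x w (suc n))
IsPos-next {x} {w} {n} {i} inf (wi , refl) with inf (suc i)
... | m , i<m , wm = map₂ proj₂ (IsPos-find n (suc m) n<c)
  where
  n<c : n < count x w (suc m)
  n<c = begin-strict
    n                  ≡⟨ count-suc-≡ i wi ⟨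
    count x w (suc i)  ≤⟨ count-mono i<m ⟩
    count x w m        <⟨ n<1+n _ ⟩
    suc (count x w m)  ≡⟨ count-suc-≡ m wm ⟨
    count x w (suc m)  ∎
    where open ≤-Reasoning

IsPos-step : ∀ {x w σ n i} → InfOften x w → ΔpFactorVia x w σ →
             IsPos x w (suc n) i → IsPos x w (suc (suc n)) (i + σ (w n))
IsPos-step {x} {w} {σ} {n} {i} inf Δ pi with IsPos-next inf pi
... | j , pj = subst (IsPos x w (suc (suc n))) i+σ≡j pj
  where
  open ≡-Reasoning
  i+σ≡j : j ≡ i + σ (w n)
  i+σ≡j = begin
    j            ≡⟨ m+[n∸m]≡n (<⇒≤ (IsPos-< pi pj)) ⟨
    i + (j ∸ i)  ≡⟨ cong (i +_) (Δ n i j pi pj) ⟩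
    i + σ (w n)  ∎

ΔpFactorVia-intro : ∀ {x w σ} (p : ℕ → ℕ) → (∀ n → IsPos x w (suc n) (p n)) →
                    (∀ n → p (suc n) ∸ p n ≡ σ (w n)) → ΔpFactorVia x w σ
ΔpFactorVia-intro {x} {w} {σ} p pos gap n i j pi pj =
  subst₂ (λ j i → j ∸ i ≡ σ (w n))
         (IsPos-functional {x} {w} (pos (suc n)) pj) (IsPos-functional {x} {w} (pos n) pi) (gap n)

ΔpFactorVia-resp-≗ : ∀ {x w σ τ} → σ ≗ τ → ΔpFactorVia x w σ → ΔpFactorVia x w τ
ΔpFactorVia-resp-≗ {w = w} σ≗τ Δ n i j pi pj = trans (Δ n i j pi pj) (σ≗τ (w n))

IsPos-resp-≈ : ∀ {x w v n i} → w ≈ v → IsPos x w n i → IsPos x v n i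
IsPos-resp-≈ {i = i} w≈v (wi , c) =
  trans (sym (w≈v i)) wi , trans (cong suc (count-cong i (λ k _ → sym (w≈v k)))) c

ΔpFactorVia-resp-≈ : ∀ {x w v σ} → w ≈ v → ΔpFactorVia x w σ → ΔpFactorVia x v σ
ΔpFactorVia-resp-≈ {σ = σ} w≈v Δ n i j pi pj =
  trans (Δ n i j (IsPos-resp-≈ v≈w pi) (IsPos-resp-≈ v≈w pj)) (cong σ (w≈v n))
  where v≈w = λ k → sym (w≈v k)

-- The gaps read inside the run are σ(x) = 1, so each places the next x right after the run.
run-persists : ∀ {x w σ n k} → InfOften x w → ΔpFactorVia x w σ → σ x ≡ 1 →
               IsPos x w (suc n) k → (∀ m → n ≤ m → m ≤ k → w m ≡ x) →
               ∀ d → w (d + k) ≡ x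
run-persists {x} {w} {σ} {n} {k} inf Δ σx≡1 pk run d = proj₁ (proj₁ (extend d))
  where
  Run : ℕ → Set
  Run d = IsPos x w (suc (d + n)) (d + k) × (∀ m → n ≤ m → m ≤ d + k → w m ≡ x)

  extend : ∀ d → Run d
  extend zero = pk , run
  extend (suc d) with extend d
  ... | p , r = p′ , r′
    where
    w-d+n≡x : w (d + n) ≡ x
    w-d+n≡x = r (d + n) (m≤n+m n d) (+-monoʳ-≤ d (IsPos-≤ pk))

    p′ : IsPos x w (suc (suc (d + n))) (suc (d + k))
    p′ = subst (IsPos x w (suc (suc (d + n)))) (begin
      d + k + σ (w (d + n))  ≡⟨ cong (λ l → d + k + σ l) w-d+n≡x ⟩
      d + k + σ x            ≡⟨ cong (d + k +_) σx≡1 ⟩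
      d + k + 1              ≡⟨ +-comm (d + k) 1 ⟩
      suc (d + k)            ∎) (IsPos-step {σ = σ} inf Δ p)
      where open ≡-Reasoning

    r′ : ∀ m → n ≤ m → m ≤ suc (d + k) → w m ≡ x
    r′ m n≤m m≤ with m≤n⇒m<n∨m≡n m≤
    ... | inj₁ m< = r m n≤m (s≤s⁻¹ m<)
    ... | inj₂ refl = proj₁ p′

eventually-constant⇒≡ : ∀ {x y w} k → InfOften y w → (∀ d → w (d + k) ≡ x) → y ≡ x
eventually-constant⇒≡ {w = w} k inf tail with inf k
... | m , k≤m , wm≡y = trans (sym wm≡y) (subst (λ i → w i ≡ _) (m∸n+n≡m k≤m) (tail (m ∸ k)))

ΔpFactorVia-unique : ∀ {x w v σ} → w 0 ≡ x → v 0 ≡ x → InfOften x w → InfOften x v →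
                     ΔpFactorVia x w σ → ΔpFactorVia x v σ → w ≈ v
ΔpFactorVia-unique {x} {w} {v} {σ} w0 v0 infw infv Δw Δv i = agreeing (common i)
  where
  -- The next x after a common one at k is at k + σ(ℓₙ) in both words, and the letters in
  -- between are the other letter in both.
  Common : ℕ → ℕ → Set
  Common n k = IsPos x w (suc n) k × IsPos x v (suc n) k × (∀ i → i ≤ k → w i ≡ v i)

  common : ∀ n → ∃ (Common n)
  common zero = 0 , (w0 , refl) , (v0 , refl) , λ { zero _ → trans w0 (sym v0) ; (suc _) () }
  common (suc n) with common n
  ... | k , pw , pv , agree = k + σ (w n) , pw′ , pv′ , agree′
    where
    pw′ = IsPos-step {σ = σ} infw Δw pw
    pv′ : IsPos x v (suc (suc n)) (k + σ (w n))
    pv′ = subst (λ l → IsPos x v (suc (suc n)) (k + σ l)) (sym (agree n (IsPos-≤ pw)))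
            (IsPos-step {σ = σ} infv Δv pv)
    agree′ : ∀ i → i ≤ k + σ (w n) → w i ≡ v i
    agree′ i i≤ with m≤n⇒m<n∨m≡n i≤ | i ≤? k
    ... | inj₂ refl | _ = trans (proj₁ pw′) (sym (proj₁ pv′))
    ... | inj₁ _ | yes i≤k = agree i i≤k
    ... | inj₁ i< | no i≰k =
      ≢-≢⇒≡ (IsPos-between pw pw′ (≰⇒> i≰k) i<) (IsPos-between pv pv′ (≰⇒> i≰k) i<)

  agreeing : ∃ (Common i) → w i ≡ v i
  agreeing (k , pw , _ , agree) = agree i (IsPos-≤ pw)

-- Fixed points of the Fibonacci substitution

imagePos : Word → ℕ → ℕ
imagePos v n = n + count a v n

-- imagePos v n is the length of ρF(ℓ₀ ⋯ ℓₙ₋₁), so the fields say that ρF(v) = v.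
record FixedByρF (v : Word) : Set where
  field
    image-head : ∀ n → v (imagePos v n) ≡ a
    image-tail : ∀ n → v n ≡ a → v (suc (imagePos v n)) ≡ b

σ-fib : Letter → ℕ
σ-fib a = 2
σ-fib b = 1

σ′-fib : Letter → ℕ
σ′-fib a = 3
σ′-fib b = 2

module FixedByρF-Properties {v : Word} (fixed : FixedByρF v) where
  open FixedByρF fixed
  open ≡-Reasoning

  private
    P : ℕ → ℕ
    P = imagePos v

  imagePos-suc-a : ∀ {n} → v n ≡ a → P (suc n) ≡ 2 + P n
  imagePos-suc-a {n} vn≡a = cong suc (trans (cong (n +_) (count-suc-≡ n vn≡a)) (+-suc n _))

  imagePos-suc-b : ∀ {n} → v n ≡ b → P (suc n) ≡ 1 + P n
  imagePos-suc-b {n} vn≡b = cong (suc ∘′ (n +_)) (count-suc-≢ n a≢b vn≡b)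

  count-a-imagePos : ∀ n → count a v (P n) ≡ n
  count-a-imagePos zero = refl
  count-a-imagePos (suc n) with letter-cases (v n)
  ... | inj₁ vn = begin
    count a v (P (suc n))   ≡⟨ cong (count a v) (imagePos-suc-a vn) ⟩
    count a v (2 + P n)     ≡⟨ count-suc-≢ (suc (P n)) a≢b (image-tail n vn) ⟩
    count a v (suc (P n))   ≡⟨ count-suc-≡ (P n) (image-head n) ⟩
    suc (count a v (P n))   ≡⟨ cong suc (count-a-imagePos n) ⟩
    suc n                   ∎
  ... | inj₂ vn = begin
    count a v (P (suc n))   ≡⟨ cong (count a v) (imagePos-suc-b vn) ⟩
    count a v (1 + P n)     ≡⟨ count-suc-≡ (P n) (image-head n) ⟩
    suc (count a v (P n))   ≡⟨ cong suc (count-a-imagePos n) ⟩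
    suc n                   ∎

  count-b-imagePos : ∀ n → count b v (P n) ≡ count a v n
  count-b-imagePos zero = refl
  count-b-imagePos (suc n) with letter-cases (v n)
  ... | inj₁ vn = begin
    count b v (P (suc n))      ≡⟨ cong (count b v) (imagePos-suc-a vn) ⟩
    count b v (2 + P n)        ≡⟨ count-suc-≡ (suc (P n)) (image-tail n vn) ⟩
    suc (count b v (1 + P n))  ≡⟨ cong suc (count-suc-≢ (P n) (λ ()) (image-head n)) ⟩
    suc (count b v (P n))      ≡⟨ cong suc (count-b-imagePos n) ⟩
    suc (count a v n)          ≡⟨ count-suc-≡ n vn ⟨
    count a v (suc n)          ∎
  ... | inj₂ vn = begin
    count b v (P (suc n))   ≡⟨ cong (count b v) (imagePos-suc-b vn) ⟩
    count b v (1 + P n)     ≡⟨ count-suc-≢ (P n) (λ ()) (image-head n) ⟩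
    count b v (P n)         ≡⟨ count-b-imagePos n ⟩
    count a v n             ≡⟨ count-suc-≢ n a≢b vn ⟨
    count a v (suc n)       ∎

  IsPos-a : ∀ n → IsPos a v (suc n) (P n)
  IsPos-a n = image-head n , cong suc (count-a-imagePos n)

  IsPos-b : ∀ n → IsPos b v (suc n) (suc (P (P n)))
  IsPos-b n = image-tail (P n) (image-head n) , cong suc (begin
    count b v (suc (P (P n)))  ≡⟨ count-suc-≢ (P (P n)) (λ ()) (image-head (P n)) ⟩
    count b v (P (P n))        ≡⟨ count-b-imagePos (P n) ⟩
    count a v (P n)            ≡⟨ count-a-imagePos n ⟩
    n                          ∎)

  Δpa : ΔpFactorVia a v σ-fib
  Δpa = ΔpFactorVia-intro {σ = σ-fib} P IsPos-a gap
    where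
    gap : ∀ n → P (suc n) ∸ P n ≡ σ-fib (v n)
    gap n with letter-cases (v n)
    ... | inj₁ vn =
      trans (cong (_∸ P n) (imagePos-suc-a vn)) (trans (m+n∸n≡m 2 (P n)) (cong σ-fib (sym vn)))
    ... | inj₂ vn =
      trans (cong (_∸ P n) (imagePos-suc-b vn)) (trans (m+n∸n≡m 1 (P n)) (cong σ-fib (sym vn)))

  Δpb : ΔpFactorVia b v σ′-fib
  Δpb = ΔpFactorVia-intro {σ = σ′-fib} (λ n → suc (P (P n))) IsPos-b gap
    where
    gap : ∀ n → P (P (suc n)) ∸ P (P n) ≡ σ′-fib (v n)
    gap n with letter-cases (v n)
    ... | inj₁ vn = begin
      P (P (suc n)) ∸ P (P n)   ≡⟨ cong (λ m → P m ∸ P (P n)) (imagePos-suc-a vn) ⟩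
      P (2 + P n) ∸ P (P n)     ≡⟨ cong (_∸ P (P n)) (imagePos-suc-b (image-tail n vn)) ⟩
      1 + P (1 + P n) ∸ P (P n) ≡⟨ cong (λ m → 1 + m ∸ P (P n)) (imagePos-suc-a (image-head n)) ⟩
      3 + P (P n) ∸ P (P n)     ≡⟨ m+n∸n≡m 3 (P (P n)) ⟩
      3                         ≡⟨ cong σ′-fib vn ⟨
      σ′-fib (v n)              ∎
    ... | inj₂ vn = begin
      P (P (suc n)) ∸ P (P n)   ≡⟨ cong (λ m → P m ∸ P (P n)) (imagePos-suc-b vn) ⟩
      P (1 + P n) ∸ P (P n)     ≡⟨ cong (_∸ P (P n)) (imagePos-suc-a (image-head n)) ⟩
      2 + P (P n) ∸ P (P n)     ≡⟨ m+n∸n≡m 2 (P (P n)) ⟩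
      2                         ≡⟨ cong σ′-fib vn ⟨
      σ′-fib (v n)              ∎

  infinitely-many-a : InfOften a v
  infinitely-many-a n = P n , m≤m+n n _ , image-head n

fibPrefix : ℕ → List Letter
fibPrefix k = iter k (a ∷ [])

fibPrefix-suc : ∀ k → fibPrefix (suc k) ≡ ρF* (fibPrefix k)
fibPrefix-suc k = iter-suc k (a ∷ [])
  where
  iter-suc : ∀ n u → iter (suc n) u ≡ ρF* (iter n u)
  iter-suc zero u = refl
  iter-suc (suc n) u = iter-suc n (ρF* u)

fibPrefix-extends : ∀ k → ∃ λ t → fibPrefix (suc k) ≡ fibPrefix k ++ t
fibPrefix-extends zero = b ∷ [] , refl
fibPrefix-extends (suc k) with fibPrefix-extends k
... | t , e = ρF* t , (begin
  fibPrefix (2 + k)           ≡⟨ fibPrefix-suc (suc k) ⟩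
  ρF* (fibPrefix (suc k))     ≡⟨ cong ρF* e ⟩
  ρF* (fibPrefix k ++ t)      ≡⟨ concatMap-++ ρF (fibPrefix k) t ⟩
  ρF* (fibPrefix k) ++ ρF* t  ≡⟨ cong (_++ ρF* t) (fibPrefix-suc k) ⟨
  fibPrefix (suc k) ++ ρF* t  ∎)
  where open ≡-Reasoning

fibPrefix-head : ∀ k → ∃ λ r → fibPrefix k ≡ a ∷ r
fibPrefix-head zero = [] , refl
fibPrefix-head (suc k) with fibPrefix-head k
... | r , e = b ∷ ρF* r , trans (fibPrefix-suc k) (cong ρF* e)

length-ρF* : ∀ u → length u ≤ length (ρF* u)
length-ρF* [] = z≤n
length-ρF* (a ∷ u) = s≤s (m≤n⇒m≤1+n (length-ρF* u))
length-ρF* (b ∷ u) = s≤s (length-ρF* u)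

length-fibPrefix : ∀ k → k < length (fibPrefix k)
length-fibPrefix zero = s≤s z≤n
length-fibPrefix (suc k) with fibPrefix-head k | length-fibPrefix k
... | r , e | k<len rewrite fibPrefix-suc k | e =
  s≤s (s≤s (≤-trans (s≤s⁻¹ k<len) (length-ρF* r)))

nthOr-++ : ∀ u t {i} → i < length u → nthOr a (u ++ t) i ≡ nthOr a u i
nthOr-++ (x ∷ u) t {zero} _ = refl
nthOr-++ (x ∷ u) t {suc i} i<len = nthOr-++ u t (s≤s⁻¹ i<len)

fib-stable : ∀ {i k} → i < k → fib i ≡ nthOr a (fibPrefix k) i
fib-stable {i} {suc k} i<1+k with m≤n⇒m<n∨m≡n (s≤s⁻¹ i<1+k)
... | inj₂ refl = refl
... | inj₁ i<k with fibPrefix-extends k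
... | t , e =
  trans (fib-stable i<k) (sym (trans (cong (λ u → nthOr a u i) e) (nthOr-++ (fibPrefix k) t i<len)))
  where i<len = <-trans i<k (length-fibPrefix k)

asWord : List Letter → Word
asWord = nthOr a

-- No bound on n is needed: past the end of u both sides read the padding letter a.

ρF*-image-head : ∀ u n → nthOr a (ρF* u) (imagePos (asWord u) n) ≡ a
ρF*-image-head [] n = refl
ρF*-image-head (a ∷ u) zero = refl
ρF*-image-head (b ∷ u) zero = refl
ρF*-image-head (a ∷ u) (suc n)
  rewrite count-suc-shift a (asWord (a ∷ u)) n | +-suc n (count a (asWord u) n) = ρF*-image-head u n
ρF*-image-head (b ∷ u) (suc n)
  rewrite count-suc-shift a (asWord (b ∷ u)) n = ρF*-image-head u n

ρF*-image-tail : ∀ u n → n < length u → nthOr a u n ≡ a →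
                 nthOr a (ρF* u) (suc (imagePos (asWord u) n)) ≡ b
ρF*-image-tail (a ∷ u) zero _ _ = refl
ρF*-image-tail (a ∷ u) (suc n) n<len un≡a
  rewrite count-suc-shift a (asWord (a ∷ u)) n | +-suc n (count a (asWord u) n) =
  ρF*-image-tail u n (s≤s⁻¹ n<len) un≡a
ρF*-image-tail (b ∷ u) (suc n) n<len un≡a
  rewrite count-suc-shift a (asWord (b ∷ u)) n = ρF*-image-tail u n (s≤s⁻¹ n<len) un≡a

module _ (n : ℕ) where
  private
    m = imagePos fib n
    u = fibPrefix (suc m)

    fib-via-ρF* : ∀ {i} → i ≤ suc m → fib i ≡ nthOr a (ρF* u) i
    fib-via-ρF* {i} i≤ =
      trans (fib-stable (s≤s i≤)) (cong (λ L → nthOr a L i) (fibPrefix-suc (suc m)))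

    n≤m : n ≤ m
    n≤m = m≤m+n n _

    m≡image : m ≡ imagePos (asWord u) n
    m≡image = cong (n +_) (count-cong n (λ i i<n → fib-stable (<-≤-trans i<n (m≤n⇒m≤1+n n≤m))))

  fib-image-head : fib (imagePos fib n) ≡ a
  fib-image-head = trans (fib-via-ρF* (n≤1+n m))
    (trans (cong (nthOr a (ρF* u)) m≡image) (ρF*-image-head u n))

  fib-image-tail : fib n ≡ a → fib (suc (imagePos fib n)) ≡ b
  fib-image-tail fib-n≡a = trans (fib-via-ρF* ≤-refl)
    (trans (cong (nthOr a (ρF* u) ∘′ suc) m≡image)
           (ρF*-image-tail u n (<-trans (s≤s n≤m) (length-fibPrefix (suc m)))
                               (trans (sym (fib-stable (s≤s n≤m))) fib-n≡a)))

fib-fixed : FixedByρF fib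
fib-fixed = record { image-head = fib-image-head ; image-tail = fib-image-tail }

-- The periodic word (ab)^ω

abω-even : ∀ n → abω (n * 2) ≡ a
abω-even zero = refl
abω-even (suc n) = abω-even n

abω-odd : ∀ n → abω (suc (n * 2)) ≡ b
abω-odd zero = refl
abω-odd (suc n) = abω-odd n

count-abω : ∀ x n → count x abω (n * 2) ≡ n
count-abω x zero = refl
count-abω a (suc n) =
  trans (count-suc-≢ (suc (n * 2)) a≢b (abω-odd n))
        (trans (count-suc-≡ (n * 2) (abω-even n)) (cong suc (count-abω a n)))
count-abω b (suc n) =
  trans (count-suc-≡ (suc (n * 2)) (abω-odd n))
        (cong suc (trans (count-suc-≢ (n * 2) (λ ()) (abω-even n)) (count-abω b n)))

abω-Δpa : ΔpFactorVia a abω (const 2)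
abω-Δpa = ΔpFactorVia-intro {σ = const 2} (_* 2) (λ n → abω-even n , cong suc (count-abω a n))
            (λ n → m+n∸n≡m 2 (n * 2))

abω-Δpb : ΔpFactorVia b abω (const 2)
abω-Δpb = ΔpFactorVia-intro {σ = const 2} (suc ∘′ (_* 2)) pos (λ n → m+n∸n≡m 2 (n * 2))
  where
  pos : ∀ n → IsPos b abω (suc n) (suc (n * 2))
  pos n = abω-odd n , cong suc (trans (count-suc-≢ (n * 2) (λ ()) (abω-even n)) (count-abω b n))

abω-infinitely-many-a : InfOften a abω
abω-infinitely-many-a n = n * 2 , m≤m*n n 2 , abω-even n

-- Gap constraints read off a finite prefix

segment : Word → ℕ → ℕ → List Letter
segment w k zero = []
segment w k (suc N) = w k ∷ segment w (suc k) N

positions : Letter → ℕ → List Letter → List ℕ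
positions x k [] = []
positions x k (y ∷ L) with x ≟ y
... | yes _ = k ∷ positions x (suc k) L
... | no _ = positions x (suc k) L

differences : List ℕ → List ℕ
differences (p ∷ q ∷ ps) = q ∸ p ∷ differences (q ∷ ps)
differences _ = []

-- (ℓₙ , Δpₓ(n+1)) for every n for which the prefix L shows both p_x(n+1) and p_x(n+2)
gaps : Letter → List Letter → List (Letter × ℕ)
gaps x L = zip L (differences (positions x 0 L))

OccurrencesFrom : Letter → Word → ℕ → List ℕ → Set
OccurrencesFrom x w c [] = ⊤
OccurrencesFrom x w c (p ∷ ps) = IsPos x w (suc c) p × OccurrencesFrom x w (suc c) ps

positions-segment : ∀ x w k N {c} → count x w k ≡ c →
                    OccurrencesFrom x w c (positions x k (segment w k N))
positions-segment x w k zero _ = tt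
positions-segment x w k (suc N) count≡c with x ≟ w k
... | yes refl = (refl , cong suc count≡c) ,
  positions-segment x w (suc k) N (trans (count-suc-≡ k refl) (cong suc count≡c))
... | no x≢wk = positions-segment x w (suc k) N (trans (count-suc-≢ k x≢wk refl) count≡c)

Realizes : (Letter → ℕ) → Letter × ℕ → Set
Realizes σ (l , d) = σ l ≡ d

zip-differences-sound : ∀ {x w σ} → ΔpFactorVia x w σ → ∀ c N ps → OccurrencesFrom x w c ps →
                        All (Realizes σ) (zip (segment w c N) (differences ps))
zip-differences-sound Δ c zero ps _ = []
zip-differences-sound Δ c (suc N) [] _ = []
zip-differences-sound Δ c (suc N) (p ∷ []) _ = []
zip-differences-sound Δ c (suc N) (p ∷ q ∷ ps) (pp , pq , occ) =
  sym (Δ c p q pp pq) ∷ zip-differences-sound Δ (suc c) N (q ∷ ps) (pq , occ)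

gaps-sound : ∀ {x w σ} → ΔpFactorVia x w σ → ∀ N → All (Realizes σ) (gaps x (segment w 0 N))
gaps-sound {x} {w} Δ N = zip-differences-sound Δ 0 N _ (positions-segment x w 0 N refl)

Consistent : List (Letter × ℕ) → Set
Consistent ps = All (λ p → All (λ q → proj₁ p ≡ proj₁ q → proj₂ p ≡ proj₂ q) ps) ps

consistent? : Decidable Consistent
consistent? ps = all? (λ p → all? (λ q → (proj₁ p ≟ proj₁ q) →-dec (proj₂ p ℕ.≟ proj₂ q)) ps) ps

realizable⇒consistent : ∀ {σ ps} → All (Realizes σ) ps → Consistent ps
realizable⇒consistent {σ} r =
  All.tabulate λ p∈ → All.tabulate λ q∈ l≡l′ →
    trans (sym (All.lookup r p∈)) (trans (cong σ l≡l′) (All.lookup r q∈))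

Verdict : List Letter → Set
Verdict L = (a , 1) ∈ gaps a L
          ⊎ nthOr a L 1 ≡ b × nthOr a L 2 ≡ b × (b , 1) ∈ gaps b L
          ⊎ (a , 2) ∈ gaps a L × (b , 1) ∈ gaps a L
          ⊎ (a , 2) ∈ gaps a L × (b , 2) ∈ gaps a L

verdict? : Decidable Verdict
verdict? L = (a , 1) ∈gaps? gaps a L
          ⊎-dec (nthOr a L 1 ≟ b) ×-dec (nthOr a L 2 ≟ b) ×-dec (b , 1) ∈gaps? gaps b L
          ⊎-dec (a , 2) ∈gaps? gaps a L ×-dec (b , 1) ∈gaps? gaps a L
          ⊎-dec (a , 2) ∈gaps? gaps a L ×-dec (b , 2) ∈gaps? gaps a L
  where
  _∈gaps?_ : ∀ p ps → Dec (p ∈ ps)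
  _∈gaps?_ = _∈?_ (≡-dec _≟_ ℕ._≟_)

EveryWord : ℕ → (List Letter → Set) → Set
EveryWord zero P = P []
EveryWord (suc n) P = EveryWord n (λ L → P (a ∷ L)) × EveryWord n (λ L → P (b ∷ L))

everyWord? : ∀ n {P} → Decidable P → Dec (EveryWord n P)
everyWord? zero P? = P? []
everyWord? (suc n) P? = everyWord? n (λ L → P? (a ∷ L)) ×-dec everyWord? n (λ L → P? (b ∷ L))

everyWord-segment : ∀ n {P} → EveryWord n P → ∀ w k → P (segment w k n)
everyWord-segment zero every w k = every
everyWord-segment (suc n) {P} every w k = everyWord-segment n (pick (w k) every) w (suc k)
  where
  pick : ∀ y → EveryWord (suc n) P → EveryWord n (λ L → P (y ∷ L))
  pick a = proj₁
  pick b = proj₂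

Settled : List Letter → Set
Settled L = Consistent (gaps a L) → Consistent (gaps b L) → Verdict L

-- Decided by evaluation over all 2⁹ continuations of a; abstract keeps the type checker from
-- unfolding that evaluation wherever the lemma is used.
abstract
  prefixes-settled : EveryWord 9 (λ L → Settled (a ∷ L))
  prefixes-settled = toWitness {a? = everyWord? 9 (λ L → settled? (a ∷ L))} _
    where
    settled? : Decidable Settled
    settled? L = consistent? (gaps a L) →-dec (consistent? (gaps b L) →-dec verdict? L)

prefix-verdict : ∀ {w σ σ′} → w 0 ≡ a → ΔpFactorVia a w σ → ΔpFactorVia b w σ′ →
                 Verdict (segment w 0 10)
prefix-verdict {w} {σ} {σ′} w0 Δa Δb =
  subst Settled (cong (_∷ segment w 1 9) (sym w0))
    (everyWord-segment 9 {λ L → Settled (a ∷ L)} prefixes-settled w 1)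
    (realizable⇒consistent (gaps-sound {w = w} {σ} Δa 10))
    (realizable⇒consistent (gaps-sound {w = w} {σ′} Δb 10))

σ-a≢1 : ∀ {w σ} → InW w → w 0 ≡ a → ΔpFactorVia a w σ → σ a ≢ 1
σ-a≢1 {w} {σ} (inf-a , inf-b) w0 Δa σa≡1 = a≢b (sym (eventually-constant⇒≡ 0 inf-b a-tail))
  where
  a-tail : ∀ d → w (d + 0) ≡ a
  a-tail = run-persists {σ = σ} inf-a Δa σa≡1 (w0 , refl) λ { zero _ _ → w0 ; (suc _) _ () }

σ′-b≢1 : ∀ {w σ′} → InW w → w 0 ≡ a → w 1 ≡ b → w 2 ≡ b → ΔpFactorVia b w σ′ → σ′ b ≢ 1
σ′-b≢1 {w} {σ′} (inf-a , inf-b) w0 w1 w2 Δb σ′b≡1 = a≢b (eventually-constant⇒≡ 2 inf-a b-tail)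
  where
  run : ∀ m → 1 ≤ m → m ≤ 2 → w m ≡ b
  run 1 _ _ = w1
  run 2 _ _ = w2
  run (suc (suc (suc _))) _ (s≤s (s≤s ()))

  count-b-2 : count b w 2 ≡ 1
  count-b-2 = trans (count-suc-≡ {b} {w} 1 w1) (cong suc (count-suc-≢ {w = w} 0 (λ ()) w0))

  b-tail : ∀ d → w (d + 2) ≡ b
  b-tail = run-persists {σ = σ′} inf-b Δb σ′b≡1 (w2 , cong suc count-b-2) run

ΔpFactorVia-forced : ∀ {w σ σ′} → InW w → w 0 ≡ a → ΔpFactorVia a w σ → ΔpFactorVia b w σ′ →
                     σ ≗ σ-fib ⊎ σ ≗ const 2
ΔpFactorVia-forced {w} {σ} {σ′} inW w0 Δa Δb = settle (prefix-verdict {σ = σ} {σ′} w0 Δa Δb)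
  where
  ra = gaps-sound {w = w} {σ} Δa 10
  rb = gaps-sound {w = w} {σ′} Δb 10

  settle : Verdict (segment w 0 10) → σ ≗ σ-fib ⊎ σ ≗ const 2
  settle (inj₁ a1∈) = contradiction (All.lookup ra a1∈) (σ-a≢1 {σ = σ} inW w0 Δa)
  settle (inj₂ (inj₁ (w1 , w2 , b1∈))) =
    contradiction (All.lookup rb b1∈) (σ′-b≢1 {σ′ = σ′} inW w0 w1 w2 Δb)
  settle (inj₂ (inj₂ (inj₁ (a2∈ , b1∈)))) = inj₁ λ { a → All.lookup ra a2∈ ; b → All.lookup ra b1∈ }
  settle (inj₂ (inj₂ (inj₂ (a2∈ , b2∈)))) = inj₂ λ { a → All.lookup ra a2∈ ; b → All.lookup ra b2∈ }

module Fib = FixedByρF-Properties fib-fixed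

σ-fib-injective : Injective _≡_ _≡_ σ-fib
σ-fib-injective {a} {a} _ = refl
σ-fib-injective {b} {b} _ = refl

σ′-fib-injective : Injective _≡_ _≡_ σ′-fib
σ′-fib-injective {a} {a} _ = refl
σ′-fib-injective {b} {b} _ = refl

fib-unique : ∀ {w σ} → InfOften a w → w 0 ≡ a → ΔpFactorVia a w σ → σ ≗ σ-fib → w ≈ fib
fib-unique inf w0 Δa σ≗ =
  ΔpFactorVia-unique {σ = σ-fib} w0 refl inf Fib.infinitely-many-a (ΔpFactorVia-resp-≗ σ≗ Δa) Fib.Δpa

abω-unique : ∀ {w σ} → InfOften a w → w 0 ≡ a → ΔpFactorVia a w σ → σ ≗ const 2 → w ≈ abω
abω-unique inf w0 Δa σ≗ =
  ΔpFactorVia-unique {σ = const 2} w0 refl inf abω-infinitely-many-a (ΔpFactorVia-resp-≗ σ≗ Δa) abω-Δpa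

≈fib⇒factors : ∀ {w} → w ≈ fib → ΔpFactorVia a w σ-fib × ΔpFactorVia b w σ′-fib
≈fib⇒factors w≈fib =
  ΔpFactorVia-resp-≈ {σ = σ-fib} fib≈w Fib.Δpa , ΔpFactorVia-resp-≈ {σ = σ′-fib} fib≈w Fib.Δpb
  where fib≈w = λ n → sym (w≈fib n)

≈abω⇒factors : ∀ {w} → w ≈ abω → ΔpFactorVia a w (const 2) × ΔpFactorVia b w (const 2)
≈abω⇒factors w≈abω =
  ΔpFactorVia-resp-≈ {σ = const 2} abω≈w abω-Δpa , ΔpFactorVia-resp-≈ {σ = const 2} abω≈w abω-Δpb
  where abω≈w = λ n → sym (w≈abω n)

theorem4p10 : (w : Word) → InW w → w 0 ≡ a →
    ((Σ (Letter → ℕ) λ σ → Σ (Letter → ℕ) λ σ′ →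
        ΔpFactorVia a w σ × ΔpFactorVia b w σ′)
      ⇔ (w ≈ fib ⊎ w ≈ abω))
    × ((Σ (Letter → ℕ) λ σ → Σ (Letter → ℕ) λ σ′ →
        Injective _≡_ _≡_ σ × Injective _≡_ _≡_ σ′ ×
        ΔpFactorVia a w σ × ΔpFactorVia b w σ′)
      ⇔ w ≈ fib)
theorem4p10 w inW@(inf-a , _) w0 =
  mk⇔ (λ (σ , σ′ , Δa , Δb) →
         Sum.map (fib-unique inf-a w0 Δa) (abω-unique inf-a w0 Δa) (forced σ σ′ Δa Δb))
      (λ { (inj₁ w≈fib) → σ-fib , σ′-fib , ≈fib⇒factors w≈fib
         ; (inj₂ w≈abω) → const 2 , const 2 , ≈abω⇒factors w≈abω }) ,
  mk⇔ (λ (σ , σ′ , σ-inj , _ , Δa , Δb) →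
         [ fib-unique inf-a w0 Δa
         , (λ σ≗2 → contradiction (σ-inj (trans (σ≗2 a) (sym (σ≗2 b)))) a≢b) ]′ (forced σ σ′ Δa Δb))
      (λ w≈fib → σ-fib , σ′-fib , (λ {x y} → σ-fib-injective) , (λ {x y} → σ′-fib-injective) ,
                 ≈fib⇒factors w≈fib)
  where
  forced : ∀ σ σ′ → ΔpFactorVia a w σ → ΔpFactorVia b w σ′ → σ ≗ σ-fib ⊎ σ ≗ const 2
  forced σ σ′ = ΔpFactorVia-forced {σ = σ} {σ′} inW w0
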